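{- Let $\mathcal{A}$ be a union-closed family with universe $[n]=\{1,\dots,n\}$ and length $\ell$. Then there exists an element $y\in[n]$ that belongs to at most $\sum_{i=0}^{\ell}\binom{n-1}{i}$ of the member sets of $\mathcal{A}$.
   Context: A family $\mathcal{A}$ is a finite family of distinct finite sets, at least one of which is nonempty. Its universe is $U(\mathcal{A})=\bigcup_{A\in\mathcal{A}}A$. $\mathcal{A}$ is union-closed if $X_1,X_2\in\mathcal{A}$ implies $X_1\cup X_2\in\mathcal{A}$. A chain in $\mathcal{A}$ is a subfamily any two of whose members are comparable under inclusion; the length $\ell(\mathcal{A})$ is one less than the maximum size of a chain in $\mathcal{A}$. -}

module Defs where

open import Data.Nat using (ℕ; suc; _∸_; _≤_)
open import Data.Nat.Combinatorics using (_C_)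
open import Data.Fin using (Fin)
open import Data.Fin.Subset using (Subset; _∪_; _⊆_; Nonempty) renaming (_∈_ to _∈ₛ_)
open import Data.Fin.Subset.Properties using (_∈?_)
open import Data.List using (List; length; filter; map; upTo)
open import Data.Nat.ListAction using (sum)
open import Data.List.Membership.Propositional using (_∈_)
open import Data.List.Relation.Unary.All using (All)
open import Data.List.Relation.Unary.Any using (Any)
open import Data.List.Relation.Unary.AllPairs using (AllPairs)
open import Data.List.Relation.Unary.Unique.Propositional using (Unique)
open import Data.Product using (Σ; _×_; ∃)
open import Data.Sum using (_⊎_)
open import Relation.Binary.PropositionalEquality using (_≡_)

IsFamily : ∀ {n} → List (Subset n) → Set
IsFamily {n} 𝒜 = Unique 𝒜 × Any Nonempty 𝒜

-- The universe of 𝒜 is exactly [n] = Fin n (every element lies in some member;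
-- members are subsets of Fin n by construction).
UniverseIsAll : ∀ {n} → List (Subset n) → Set
UniverseIsAll {n} 𝒜 = ∀ (x : Fin n) → Any (λ A → x ∈ₛ A) 𝒜

UnionClosed : ∀ {n} → List (Subset n) → Set
UnionClosed 𝒜 = ∀ {X Y} → X ∈ 𝒜 → Y ∈ 𝒜 → (X ∪ Y) ∈ 𝒜

Comparable : ∀ {n} → Subset n → Subset n → Set
Comparable X Y = X ⊆ Y ⊎ Y ⊆ X

IsChainIn : ∀ {n} → List (Subset n) → List (Subset n) → Set
IsChainIn 𝒜 𝒞 = Unique 𝒞 × All (_∈ 𝒜) 𝒞 × AllPairs Comparable 𝒞

HasLength : ∀ {n} → List (Subset n) → ℕ → Set
HasLength 𝒜 ℓ =
  (Σ _ λ 𝒞 → IsChainIn 𝒜 𝒞 × length 𝒞 ≡ suc ℓ) ×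
  (∀ 𝒞 → IsChainIn 𝒜 𝒞 → length 𝒞 ≤ suc ℓ)

degree : ∀ {n} → List (Subset n) → Fin n → ℕ
degree 𝒜 y = length (filter (λ A → y ∈? A) 𝒜)

binomSum : ℕ → ℕ → ℕ
binomSum n ℓ = sum (map (λ i → (n ∸ 1) C i) (upTo (suc ℓ)))

module Submission where

-- Every element y satisfies the bound; take y = 0.  The sets B with B ∪ {0} ∈ 𝒜 form a
-- union-closed family on n − 1 points whose chains have at most ℓ + 1 members, so it suffices
-- that a union-closed family ℱ on m points without chains of L + 1 members has
-- |ℱ| ≤ ∑_{i<L} C(m, i).  Induct on m, splitting ℱ at the point 0:
-- |ℱ| = |trace| + |doubled|, where trace = {B : B ∈ ℱ or B + 0 ∈ ℱ} and
-- doubled = {B : B ∈ ℱ and B + 0 ∈ ℱ} are again union-closed.  Lifting each B in the trace to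
-- its largest preimage shows that the trace has no longer chains than ℱ, and a chain
-- B₁ ⊂ B₂ ⊂ ⋯ in doubled gives the longer chain B₁ ⊂ B₁ + 0 ⊂ B₂ + 0 ⊂ ⋯ in ℱ, so doubled
-- has chains with at most L − 1 members.  Pascal's rule closes the induction.

open import Defs

open import Algebra.Properties.CommutativeSemigroup using (interchange)
open import Data.Bool using (Bool; true; false; not; _∧_; _∨_; T; if_then_else_)
open import Data.Bool.Properties using (T-∧; T-∨; T-≡; T-not-≡; ∧-identityʳ) renaming (_≟_ to _≟ᵇ_)
open import Data.Empty using (⊥-elim)
open import Data.Fin using (Fin; zero)
open import Data.Fin.Subset using (Subset; _∪_; _⊆_; _⊂_; outside; inside) renaming (_∈_ to _∈ₛ_)
open import Data.Fin.Subset.Properties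
  using (⊆-refl; ⊆-antisym; q⊆p∪q; x∈p∪q⁻; ⊂-irref; s⊂s; out⊂; out⊂in; in⊂in) renaming (_∈?_ to _∈ₛ?_)
open import Data.List using (List; []; _∷_; length; map; filter; upTo)
open import Data.List.Properties using (length-map; map-applyUpTo; map-cong)
import Data.List.Membership.DecPropositional as DecMembership
open import Data.List.Relation.Unary.All as All using (All; []; _∷_)
import Data.List.Relation.Unary.All.Properties as All
open import Data.List.Relation.Unary.AllPairs as AllPairs using (AllPairs; []; _∷_)
import Data.List.Relation.Unary.AllPairs.Properties as AllPairs
open import Data.List.Relation.Unary.Any using (satisfied)
open import Data.List.Relation.Unary.Unique.Propositional using (Unique)
import Data.List.Relation.Unary.Unique.Propositional.Properties as Unique
open import Data.Nat using (ℕ; zero; suc; _+_; _≤_; z≤n; s≤s)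
open import Data.Nat.Combinatorics using (_C_; nCk+nC[k+1]≡[n+1]C[k+1])
open import Data.Nat.ListAction using (sum)
open import Data.Nat.Properties
  using (+-suc; +-comm; +-mono-≤; +-commutativeSemigroup; ≤-trans; ≤-reflexive; ≤-pred; module ≤-Reasoning)
open import Data.Product using (∃; _,_; _×_; proj₁; proj₂)
open import Data.Sum using (_⊎_; inj₁; inj₂; [_,_])
open import Data.Vec using ([]; _∷_; head; here)
open import Data.Vec.Properties using (≡-dec)
open import Function using (_∘_; id)
open import Function.Bundles using (_⇔_; module Equivalence)
open import Relation.Binary.Definitions using (DecidableEquality)
open import Relation.Binary.PropositionalEquality
  using (_≡_; _≢_; _≗_; refl; sym; trans; cong; cong₂; subst; module ≡-Reasoning)
open import Relation.Nullary using (¬_; does)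
open import Relation.Nullary.Decidable using (⌊_⌋; dec-false; toWitness; fromWitness)

open Equivalence using (to; from)

_≟_ : ∀ {m} → DecidableEquality (Subset m)
_≟_ = ≡-dec _≟ᵇ_

count : ∀ m → (Subset m → Bool) → ℕ
count zero    P = if P [] then 1 else 0
count (suc m) P = count m (P ∘ (outside ∷_)) + count m (P ∘ (inside ∷_))

count-cong : ∀ m {P Q : Subset m → Bool} → P ≗ Q → count m P ≡ count m Q
count-cong zero    P≗Q = cong (λ b → if b then 1 else 0) (P≗Q [])
count-cong (suc m) P≗Q =
  cong₂ _+_ (count-cong m (P≗Q ∘ (outside ∷_))) (count-cong m (P≗Q ∘ (inside ∷_)))

count-empty : ∀ m {P : Subset m → Bool} → (∀ X → ¬ T (P X)) → count m P ≡ 0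
count-empty zero {P} ¬P with P [] | ¬P []
... | false | _  = refl
... | true  | ¬t = ⊥-elim (¬t _)
count-empty (suc m) ¬P =
  cong₂ _+_ (count-empty m (¬P ∘ (outside ∷_))) (count-empty m (¬P ∘ (inside ∷_)))

count-∨-∧ : ∀ m (P Q : Subset m → Bool) →
            count m P + count m Q ≡ count m (λ X → P X ∨ Q X) + count m (λ X → P X ∧ Q X)
count-∨-∧ zero P Q with P [] | Q []
... | true  | true  = refl
... | true  | false = refl
... | false | true  = refl
... | false | false = refl
count-∨-∧ (suc m) P Q = begin
  (count m P₀ + count m P₁) + (count m Q₀ + count m Q₁)
    ≡⟨ interchange +-commutativeSemigroup (count m P₀) (count m P₁) (count m Q₀) (count m Q₁) ⟩
  (count m P₀ + count m Q₀) + (count m P₁ + count m Q₁)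
    ≡⟨ cong₂ _+_ (count-∨-∧ m P₀ Q₀) (count-∨-∧ m P₁ Q₁) ⟩
  (count m ∨₀ + count m ∧₀) + (count m ∨₁ + count m ∧₁)
    ≡⟨ interchange +-commutativeSemigroup (count m ∨₀) (count m ∧₀) (count m ∨₁) (count m ∧₁) ⟩
  (count m ∨₀ + count m ∨₁) + (count m ∧₀ + count m ∧₁) ∎
  where
  open ≡-Reasoning
  P₀ P₁ Q₀ Q₁ ∨₀ ∨₁ ∧₀ ∧₁ : Subset m → Bool
  P₀ = P ∘ (outside ∷_)
  P₁ = P ∘ (inside ∷_)
  Q₀ = Q ∘ (outside ∷_)
  Q₁ = Q ∘ (inside ∷_)
  ∨₀ X = P₀ X ∨ Q₀ X
  ∨₁ X = P₁ X ∨ Q₁ X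
  ∧₀ X = P₀ X ∧ Q₀ X
  ∧₁ X = P₁ X ∧ Q₁ X

count-remove : ∀ m (P : Subset m → Bool) {X} → T (P X) →
               count m P ≡ suc (count m (λ Y → P Y ∧ not (does (Y ≟ X))))
count-remove zero P {[]} pX with P []
... | true = refl
count-remove (suc m) P {outside ∷ X} pX =
  cong₂ _+_ (count-remove m (P ∘ (outside ∷_)) pX) (count-cong m (sym ∘ ∧-identityʳ ∘ P ∘ (inside ∷_)))
count-remove (suc m) P {inside ∷ X} pX =
  trans (cong₂ _+_ (count-cong m (sym ∘ ∧-identityʳ ∘ P ∘ (outside ∷_)))
                   (count-remove m (P ∘ (inside ∷_)) pX))
        (+-suc _ _)

length≤count : ∀ m {P : Subset m → Bool} {Xs} → Unique Xs → All (T ∘ P) Xs → length Xs ≤ count m P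
length≤count m [] [] = z≤n
length≤count m {P} {X ∷ Xs} (X∉Xs ∷ unique) (pX ∷ pXs) = begin
  suc (length Xs)                                  ≤⟨ s≤s (length≤count m unique (All.zipWith kept (X∉Xs , pXs))) ⟩
  suc (count m (λ Y → P Y ∧ not (does (Y ≟ X)))) ≡⟨ count-remove m P pX ⟨
  count m P                                        ∎
  where
  open ≤-Reasoning
  kept : ∀ {Y} → X ≢ Y × T (P Y) → T (P Y ∧ not (does (Y ≟ X)))
  kept {Y} (X≢Y , pY) = from T-∧ (pY , from T-not-≡ (dec-false (Y ≟ X) (X≢Y ∘ sym)))

sumChoose : ℕ → ℕ → ℕ
sumChoose m L = sum (map (m C_) (upTo L))

sum-upTo-suc : ∀ (f : ℕ → ℕ) L → sum (map f (upTo (suc L))) ≡ f 0 + sum (map (f ∘ suc) (upTo L))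
sum-upTo-suc f L =
  cong (λ xs → f 0 + sum xs) (trans (map-applyUpTo suc f L) (sym (map-applyUpTo id (f ∘ suc) L)))

sum-map-+ : ∀ (f g : ℕ → ℕ) xs → sum (map (λ i → f i + g i) xs) ≡ sum (map f xs) + sum (map g xs)
sum-map-+ f g []       = refl
sum-map-+ f g (x ∷ xs) =
  trans (cong (f x + g x +_) (sum-map-+ f g xs))
        (interchange +-commutativeSemigroup (f x) (g x) (sum (map f xs)) (sum (map g xs)))

sumChoose-pascal : ∀ m L → sumChoose (suc m) (suc L) ≡ sumChoose m (suc L) + sumChoose m L
sumChoose-pascal m L = begin
  sumChoose (suc m) (suc L)                                ≡⟨ sum-upTo-suc (suc m C_) L ⟩
  1 + sum (map (λ i → suc m C suc i) (upTo L))             ≡⟨ cong (λ xs → 1 + sum xs) (map-cong pascal (upTo L)) ⟨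
  1 + sum (map (λ i → m C i + m C suc i) (upTo L))         ≡⟨ cong (1 +_) (sum-map-+ (m C_) ((m C_) ∘ suc) (upTo L)) ⟩
  1 + (sumChoose m L + sum (map ((m C_) ∘ suc) (upTo L)))  ≡⟨ cong (1 +_) (+-comm (sumChoose m L) _) ⟩
  (1 + sum (map ((m C_) ∘ suc) (upTo L))) + sumChoose m L  ≡⟨ cong (_+ sumChoose m L) (sum-upTo-suc (m C_) L) ⟨
  sumChoose m (suc L) + sumChoose m L                      ∎
  where
  open ≡-Reasoning
  pascal : ∀ i → m C i + m C suc i ≡ suc m C suc i
  pascal = nCk+nC[k+1]≡[n+1]C[k+1] m

map-AllPairs : ∀ {a b r s q} {A : Set a} {B : Set b} {R : A → A → Set r} {S : B → B → Set s} {Q : A → Set q}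
               (f : A → B) → (∀ {x y} → Q x → Q y → R x y → S (f x) (f y)) →
               ∀ {xs} → All Q xs → AllPairs R xs → AllPairs S (map f xs)
map-AllPairs f f-mono []         []          = []
map-AllPairs f f-mono (qx ∷ qxs) (rx ∷ rxs) =
  All.map⁺ (All.zipWith (λ (qy , r) → f-mono qx qy r) (qxs , rx)) ∷ map-AllPairs f f-mono qxs rxs

∷-⊂ : ∀ {m} {a b} {X Y : Subset m} → (T a → T b) → X ⊂ Y → (a ∷ X) ⊂ (b ∷ Y)
∷-⊂ {a = false}            _   = out⊂
∷-⊂ {a = true} {b = true}  _   = s⊂s
∷-⊂ {a = true} {b = false} a⇒b = ⊥-elim (a⇒b _)

⊆⇒∪≡ : ∀ {m} {X Y : Subset m} → X ⊆ Y → X ∪ Y ≡ Y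
⊆⇒∪≡ {X = X} {Y} X⊆Y =
  ⊆-antisym (λ x∈X∪Y → [ X⊆Y , id ] (x∈p∪q⁻ X Y x∈X∪Y)) (q⊆p∪q X Y)

∪-Closed : ∀ {m} → (Subset m → Bool) → Set
∪-Closed P = ∀ {X Y} → T (P X) → T (P Y) → T (P (X ∪ Y))

ChainsBoundedBy : ∀ {m} → (Subset m → Bool) → ℕ → Set
ChainsBoundedBy P L = ∀ Xs → AllPairs _⊂_ Xs → All (T ∘ P) Xs → length Xs ≤ L

chainsBoundedBy-0⇒empty : ∀ {m} {P : Subset m → Bool} → ChainsBoundedBy P 0 → ∀ X → ¬ T (P X)
chainsBoundedBy-0⇒empty bounded X pX with bounded (X ∷ []) ([] ∷ []) (pX ∷ [])
... | ()

module _ {m : ℕ} (P : Subset (suc m) → Bool) where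

  trace doubled : Subset m → Bool
  trace   X = P (outside ∷ X) ∨ P (inside ∷ X)
  doubled X = P (outside ∷ X) ∧ P (inside ∷ X)

  T-trace : ∀ {X} → T (trace X) ⇔ (T (P (outside ∷ X)) ⊎ T (P (inside ∷ X)))
  T-trace {X} = T-∨ {P (outside ∷ X)} {P (inside ∷ X)}

  trace-intro : ∀ a {X} → T (P (a ∷ X)) → T (trace X)
  trace-intro false = from T-trace ∘ inj₁
  trace-intro true  = from T-trace ∘ inj₂

  trace-elim : ∀ {X} → T (trace X) → ∃ λ a → T (P (a ∷ X))
  trace-elim = [ (false ,_) , (true ,_) ] ∘ to T-trace

  trace-∪-closed : ∪-Closed P → ∪-Closed trace
  trace-∪-closed closed pX pY with trace-elim pX | trace-elim pY
  ... | a , paX | b , pbY = trace-intro (a ∨ b) (closed paX pbY)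

  doubled-∪-closed : ∪-Closed P → ∪-Closed doubled
  doubled-∪-closed closed pX pY with to T-∧ pX | to T-∧ pY
  ... | p₀X , p₁X | p₀Y , p₁Y = from T-∧ (closed p₀X p₀Y , closed p₁X p₁Y)

  -- Maximality of the lift is what makes it monotone, via union-closedness.
  lift : Subset m → Subset (suc m)
  lift X = P (inside ∷ X) ∷ X

  lift-∈ : ∀ X → T (trace X) → T (P (lift X))
  lift-∈ X pX with P (inside ∷ X) in p₁X
  ... | true  = from T-≡ p₁X
  ... | false = [ id , (λ ()) ] (to (T-∨ {P (outside ∷ X)}) pX)

  lift-⊂ : ∪-Closed P → ∀ {X Y} → T (P (lift Y)) → X ⊂ Y → lift X ⊂ lift Y
  lift-⊂ closed {X} {Y} pY X⊂Y = ∷-⊂ p₁X⇒p₁Y X⊂Y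
    where
    p₁X⇒p₁Y : T (P (inside ∷ X)) → T (P (inside ∷ Y))
    p₁X⇒p₁Y p₁X = subst (T ∘ P ∘ (inside ∷_)) (⊆⇒∪≡ (proj₁ X⊂Y)) (closed p₁X pY)

  trace-chainsBoundedBy : ∪-Closed P → ∀ {L} → ChainsBoundedBy P L → ChainsBoundedBy trace L
  trace-chainsBoundedBy closed {L} bounded Xs chain pXs =
    subst (_≤ L) (length-map lift Xs)
      (bounded (map lift Xs) (map-AllPairs lift (λ _ → lift-⊂ closed) lifted chain) (All.map⁺ lifted))
    where
    lifted : All (T ∘ P ∘ lift) Xs
    lifted = All.map (lift-∈ _) pXs

  doubled-chainsBoundedBy : ∀ {L} → ChainsBoundedBy P (suc L) → ChainsBoundedBy doubled L
  doubled-chainsBoundedBy bounded []       _                 _          = z≤n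
  doubled-chainsBoundedBy {L} bounded (X ∷ Ys) (X⊂Ys ∷ chain) (pX ∷ pYs) =
    subst (_≤ L) (length-map (inside ∷_) (X ∷ Ys)) (≤-pred (bounded longer longer-chain longer-∈))
    where
    longer = (outside ∷ X) ∷ map (inside ∷_) (X ∷ Ys)
    longer-chain : AllPairs _⊂_ longer
    longer-chain = All.map⁺ (All.map out⊂in (⊆-refl ∷ All.map proj₁ X⊂Ys))
                 ∷ AllPairs.map⁺ (AllPairs.map in⊂in (X⊂Ys ∷ chain))
    longer-∈ : All (T ∘ P) longer
    longer-∈ = proj₁ (to T-∧ pX) ∷ All.map⁺ (All.map (proj₂ ∘ to T-∧) (pX ∷ pYs))

count≤sumChoose : ∀ m L {P : Subset m → Bool} → ∪-Closed P → ChainsBoundedBy P L →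
                  count m P ≤ sumChoose m L
count≤sumChoose m       zero        _ bounded = ≤-reflexive (count-empty m (chainsBoundedBy-0⇒empty bounded))
count≤sumChoose zero    (suc L) {P} _ _ with P []
... | true  = s≤s z≤n
... | false = z≤n
count≤sumChoose (suc m) (suc L) {P} closed bounded = begin
  count (suc m) P                         ≡⟨ count-∨-∧ m (P ∘ (outside ∷_)) (P ∘ (inside ∷_)) ⟩
  count m (trace P) + count m (doubled P) ≤⟨ +-mono-≤ trace-bound doubled-bound ⟩
  sumChoose m (suc L) + sumChoose m L     ≡⟨ sumChoose-pascal m L ⟨
  sumChoose (suc m) (suc L)               ∎
  where
  open ≤-Reasoning
  trace-bound : count m (trace P) ≤ sumChoose m (suc L)
  trace-bound = count≤sumChoose m (suc L) (trace-∪-closed P closed) (trace-chainsBoundedBy P closed bounded)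
  doubled-bound : count m (doubled P) ≤ sumChoose m L
  doubled-bound = count≤sumChoose m L (doubled-∪-closed P closed) (doubled-chainsBoundedBy P bounded)

zero∈⇒head : ∀ {m} {X : Subset (suc m)} → zero ∈ₛ X → T (head X)
zero∈⇒head here = _

⊂⇒≢ : ∀ {m} {X Y : Subset m} → X ⊂ Y → X ≢ Y
⊂⇒≢ X⊂Y X≡Y = ⊂-irref X≡Y X⊂Y

module _ {m : ℕ} (𝒜 : List (Subset (suc m))) where

  open DecMembership (_≟_ {suc m}) using (_∈?_)

  link : Subset m → Bool
  link X = ⌊ (inside ∷ X) ∈? 𝒜 ⌋

  link-∪-closed : UnionClosed 𝒜 → ∪-Closed link
  link-∪-closed closed pX pY = fromWitness (closed (toWitness pX) (toWitness pY))

  link-chainsBoundedBy : ∀ {L} → (∀ 𝒞 → IsChainIn 𝒜 𝒞 → length 𝒞 ≤ L) → ChainsBoundedBy link L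
  link-chainsBoundedBy {L} bounded Xs chain pXs =
    subst (_≤ L) (length-map (inside ∷_) Xs)
      (bounded (map (inside ∷_) Xs)
        (AllPairs.map ⊂⇒≢ lifted , All.map⁺ (All.map toWitness pXs) , AllPairs.map (inj₁ ∘ proj₁) lifted))
    where
    lifted : AllPairs _⊂_ (map (inside ∷_) Xs)
    lifted = AllPairs.map⁺ (AllPairs.map in⊂in chain)

  degree-zero≤count-link : Unique 𝒜 → degree 𝒜 zero ≤ count m link
  degree-zero≤count-link unique = begin
    degree 𝒜 zero                               ≤⟨ length≤count (suc m) (Unique.filter⁺ (zero ∈ₛ?_) unique) containing ⟩
    count (suc m) (λ X → head X ∧ ⌊ X ∈? 𝒜 ⌋) ≡⟨ cong (_+ count m link) (count-empty m (λ _ ())) ⟩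
    count m link                                ∎
    where
    open ≤-Reasoning
    containing : All (λ X → T (head X ∧ ⌊ X ∈? 𝒜 ⌋)) (filter (zero ∈ₛ?_) 𝒜)
    containing = All.zipWith (λ (0∈X , X∈𝒜) → from T-∧ (zero∈⇒head 0∈X , fromWitness X∈𝒜))
                   (All.all-filter (zero ∈ₛ?_) 𝒜 , All.filter⁺ (zero ∈ₛ?_) (All.tabulate id))

corollary2p1 : ∀ (n : ℕ) (𝒜 : List (Subset n)) (ℓ : ℕ) →
    IsFamily 𝒜 → UniverseIsAll 𝒜 → UnionClosed 𝒜 → HasLength 𝒜 ℓ →
    ∃ λ (y : Fin n) → degree 𝒜 y ≤ binomSum n ℓ
corollary2p1 zero    𝒜 ℓ (_ , nonempty) _ _ _ with satisfied nonempty
... | _ , () , _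
corollary2p1 (suc m) 𝒜 ℓ (unique , _) _ closed (_ , bounded) =
  zero , ≤-trans (degree-zero≤count-link 𝒜 unique)
                 (count≤sumChoose m (suc ℓ) (link-∪-closed 𝒜 closed) (link-chainsBoundedBy 𝒜 bounded))
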